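{- Let $Q_2(x,y,z)=x^2+2y^2+2yz+2z^2$ and let $m$ be an integer. If $m$ is not represented by $Q_2$, then $4m$ is not represented by $Q_2$.
   Context: An integer $n$ is represented by a form $Q(x,y,z)$ if there exist integers $x,y,z$ with $Q(x,y,z)=n$. -}

module Defs where

open import Data.Integer using (ℤ; _+_; _*_; +_)
open import Data.Product using (∃-syntax)
open import Relation.Binary.PropositionalEquality using (_≡_)

Q₂ : ℤ → ℤ → ℤ → ℤ
Q₂ x y z = x * x + + 2 * (y * y) + + 2 * (y * z) + + 2 * (z * z)

RepresentedByQ₂ : ℤ → Set
RepresentedByQ₂ n = ∃[ x ] ∃[ y ] ∃[ z ] Q₂ x y z ≡ n

-- Write x = r + 2a, y = s + 2b, z = t + 2c with r, s, t ∈ {0, 1}. Then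
-- Q₂(x, y, z) ≡ Q₂(r, s, t) (mod 4), and of the eight values of Q₂ on
-- {0, 1}³ only Q₂(0, 0, 0) = 0 is divisible by 4. So Q₂(x, y, z) = 4m forces
-- x, y, z to be even, and dividing by 4 represents m by Q₂(a, b, c).
{-# OPTIONS --safe #-}
module Submission where

open import Defs
open import Data.Integer using (ℤ; _*_; +_; _+_)
open import Data.Integer.Properties using (+-identityˡ; *-comm; *-cancelˡ-≡)
open import Data.Integer.DivMod using (_/_; _%_; a≡a%n+[a/n]*n; n%d<d)
open import Data.Integer.Divisibility.Signed
  using (_∣_; divides; ∣-refl; ∣m⇒∣m*n; ∣m+n∣n⇒∣m; ∣⇒∣ᵤ)
open import Data.Integer.Tactic.RingSolver using (solve-∀)
import Data.Nat as ℕ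
open import Data.Nat using (z≤n; s≤s)
open import Data.Nat.Divisibility using (_∣?_)
open import Data.Product using (∃-syntax; _,_; _×_)
open import Data.Empty using (⊥-elim)
open import Relation.Nullary using (¬_)
open import Relation.Nullary.Decidable using (False; toWitnessFalse)
open import Relation.Binary.PropositionalEquality using (_≡_; refl; sym; trans; subst)

-- The symmetric bilinear form of Q₂, so that Q₂ v = B₂ v v.
B₂ : ℤ → ℤ → ℤ → ℤ → ℤ → ℤ → ℤ
B₂ x₁ x₂ x₃ y₁ y₂ y₃ =
  x₁ * y₁ + + 2 * (x₂ * y₂) + x₂ * y₃ + x₃ * y₂ + + 2 * (x₃ * y₃)

Q₂-scale-2 : ∀ a b c → Q₂ (a * + 2) (b * + 2) (c * + 2) ≡ + 4 * Q₂ a b c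
Q₂-scale-2 = expanded
  where
  -- solve-∀ does not unfold Q₂, so the identities are stated on its expansion.
  expanded : ∀ a b c →
    (a * + 2) * (a * + 2) + + 2 * ((b * + 2) * (b * + 2))
      + + 2 * ((b * + 2) * (c * + 2)) + + 2 * ((c * + 2) * (c * + 2))
    ≡ + 4 * (a * a + + 2 * (b * b) + + 2 * (b * c) + + 2 * (c * c))
  expanded = solve-∀

Q₂-shift-2 : ∀ x y z a b c →
  Q₂ (x + a * + 2) (y + b * + 2) (z + c * + 2)
    ≡ Q₂ x y z + + 4 * (Q₂ a b c + B₂ x y z a b c)
Q₂-shift-2 = expanded
  where
  expanded : ∀ x y z a b c →
    (x + a * + 2) * (x + a * + 2) + + 2 * ((y + b * + 2) * (y + b * + 2))
      + + 2 * ((y + b * + 2) * (z + c * + 2)) + + 2 * ((z + c * + 2) * (z + c * + 2))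
    ≡ (x * x + + 2 * (y * y) + + 2 * (y * z) + + 2 * (z * z))
      + + 4 * ((a * a + + 2 * (b * b) + + 2 * (b * c) + + 2 * (c * c))
               + (x * a + + 2 * (y * b) + y * c + z * b + + 2 * (z * c)))
  expanded = solve-∀

Q₂-shift-2-∣4 : ∀ x y z a b c →
  + 4 ∣ Q₂ (x + a * + 2) (y + b * + 2) (z + c * + 2) → + 4 ∣ Q₂ x y z
Q₂-shift-2-∣4 x y z a b c 4∣Q =
  ∣m+n∣n⇒∣m (subst (+ 4 ∣_) (Q₂-shift-2 x y z a b c) 4∣Q) (∣m⇒∣m*n _ ∣-refl)

parity-split : ∀ x → ∃[ r ] ∃[ a ] r ℕ.< 2 × x ≡ + r + a * + 2
parity-split x = x % + 2 , x / + 2 , n%d<d x (+ 2) , a≡a%n+[a/n]*n x (+ 2)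

4∤ : ∀ n {n≢0 : False (4 ∣? n)} → ¬ (+ 4 ∣ + n)
4∤ n {n≢0} 4∣n = toWitnessFalse n≢0 (∣⇒∣ᵤ 4∣n)

Q₂-bits-∣4 : ∀ {r s t} → r ℕ.< 2 → s ℕ.< 2 → t ℕ.< 2 →
  + 4 ∣ Q₂ (+ r) (+ s) (+ t) → r ≡ 0 × s ≡ 0 × t ≡ 0
Q₂-bits-∣4 (s≤s z≤n)       (s≤s z≤n)       (s≤s z≤n)       _ = refl , refl , refl
Q₂-bits-∣4 (s≤s z≤n)       (s≤s z≤n)       (s≤s (s≤s z≤n)) 4∣ = ⊥-elim (4∤ 2 4∣)
Q₂-bits-∣4 (s≤s z≤n)       (s≤s (s≤s z≤n)) (s≤s z≤n)       4∣ = ⊥-elim (4∤ 2 4∣)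
Q₂-bits-∣4 (s≤s z≤n)       (s≤s (s≤s z≤n)) (s≤s (s≤s z≤n)) 4∣ = ⊥-elim (4∤ 6 4∣)
Q₂-bits-∣4 (s≤s (s≤s z≤n)) (s≤s z≤n)       (s≤s z≤n)       4∣ = ⊥-elim (4∤ 1 4∣)
Q₂-bits-∣4 (s≤s (s≤s z≤n)) (s≤s z≤n)       (s≤s (s≤s z≤n)) 4∣ = ⊥-elim (4∤ 3 4∣)
Q₂-bits-∣4 (s≤s (s≤s z≤n)) (s≤s (s≤s z≤n)) (s≤s z≤n)       4∣ = ⊥-elim (4∤ 3 4∣)
Q₂-bits-∣4 (s≤s (s≤s z≤n)) (s≤s (s≤s z≤n)) (s≤s (s≤s z≤n)) 4∣ = ⊥-elim (4∤ 7 4∣)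

Q₂-∣4⇒even : ∀ x y z → + 4 ∣ Q₂ x y z → + 2 ∣ x × + 2 ∣ y × + 2 ∣ z
Q₂-∣4⇒even x y z 4∣Q
  with parity-split x | parity-split y | parity-split z
... | r , a , r<2 , refl | s , b , s<2 , refl | t , c , t<2 , refl
  with Q₂-bits-∣4 r<2 s<2 t<2 (Q₂-shift-2-∣4 (+ r) (+ s) (+ t) a b c 4∣Q)
... | refl , refl , refl = even a , even b , even c
  where
  even : ∀ q → + 2 ∣ + 0 + q * + 2
  even q = divides q (+-identityˡ (q * + 2))

mainTheorem5 : (m : ℤ) → ¬ RepresentedByQ₂ m → ¬ RepresentedByQ₂ (+ 4 * m)
mainTheorem5 m m-unrepresented (x , y , z , Q≡4m)
  with Q₂-∣4⇒even x y z (divides m (trans Q≡4m (*-comm (+ 4) m)))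
... | divides a refl , divides b refl , divides c refl =
  m-unrepresented (a , b , c , *-cancelˡ-≡ (+ 4) _ _ (trans (sym (Q₂-scale-2 a b c)) Q≡4m))
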